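{- Let $\mathbf{k}=(k_1,\ldots,k_r)\in\mathbb{N}^r$, $\mathbf{x}=(x_1,\ldots,x_r)$ with $|x_j|\le1$, $l\in\mathbb{N}_0$ and $n\in\mathbb{N}$. Then \[ \sum_{n\ge n_1\ge n_2\ge\cdots\ge n_r>0}\prod_{j=1}^r\frac{x_j^{n_j+l}}{(n_j+l)^{k_j}}=(-1)^r\sum_{j=0}^r(-1)^j\zeta^\star_{n+l}(k_1,\ldots,k_j;x_1,\ldots,x_j)\,\zeta_l(k_r,k_{r-1},\ldots,k_{j+1};x_r,x_{r-1},\ldots,x_{j+1}). \]
   Context: $\zeta_N(k_1,\ldots,k_s;y_1,\ldots,y_s)=\sum_{N\ge n_1>\cdots>n_s\ge1}\prod_i y_i^{n_i}/n_i^{k_i}$ and $\zeta^\star_N(k_1,\ldots,k_s;y_1,\ldots,y_s)=\sum_{N\ge n_1\ge\cdots\ge n_s\ge1}\prod_i y_i^{n_i}/n_i^{k_i}$, with value $1$ for the empty index and empty sums equal to $0$. -}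

module Defs where

open import Level using (Level)
open import Algebra.Bundles using (CommutativeRing)
open import Data.Nat using (ℕ; zero; suc; _∸_) renaming (_+_ to _+ℕ_)
open import Data.List using (List; []; _∷_; take; drop; reverse; upTo; map; foldr)
open import Data.Product using (_×_; _,_)
open import Data.Vec using (Vec; zip; toList)

-- Multiple (star) zeta sums with coefficients in a commutative ring R in
-- which the positive integers are invertible; `inv m` plays the role of 1/m.
module Zeta {c ℓ : Level} (R : CommutativeRing c ℓ) (inv : ℕ → CommutativeRing.Carrier R) where
  open CommutativeRing R

  pow : Carrier → ℕ → Carrier
  pow a zero    = 1#
  pow a (suc m) = a * pow a m

  sum1 : ℕ → (ℕ → Carrier) → Carrier
  sum1 zero    f = 0#
  sum1 (suc N) f = sum1 N f + f (suc N)

  natR : ℕ → Carrier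
  natR m = sum1 m (λ _ → 1#)

  InvertsPositive : Set ℓ
  InvertsPositive = ∀ m → inv (suc m) * natR (suc m) ≈ 1#

  term : ℕ → Carrier → ℕ → Carrier
  term k y m = pow y m * pow (inv m) k

  -- ζ_N(k_1,…,k_s; y_1,…,y_s) = Σ_{N ≥ n_1 > ⋯ > n_s ≥ 1} ∏ y_i^{n_i}/n_i^{k_i}
  -- (index given as the list of pairs (k_i , y_i))
  zeta : ℕ → List (ℕ × Carrier) → Carrier
  zeta N []             = 1#
  zeta N ((k , y) ∷ ks) = sum1 N (λ m → term k y m * zeta (m ∸ 1) ks)

  -- ζ⋆_N(k_1,…,k_s; y_1,…,y_s) = Σ_{N ≥ n_1 ≥ ⋯ ≥ n_s ≥ 1} ∏ y_i^{n_i}/n_i^{k_i}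
  zetaStar : ℕ → List (ℕ × Carrier) → Carrier
  zetaStar N []             = 1#
  zetaStar N ((k , y) ∷ ks) = sum1 N (λ m → term k y m * zetaStar m ks)

  -- Σ_{N ≥ n_1 ≥ ⋯ ≥ n_r > 0} ∏_j x_j^{n_j+l}/(n_j+l)^{k_j}
  shiftedStar : ℕ → ℕ → List (ℕ × Carrier) → Carrier
  shiftedStar l N []             = 1#
  shiftedStar l N ((k , y) ∷ ks) = sum1 N (λ m → term k y (m +ℕ l) * shiftedStar l m ks)

  sumTo : ℕ → (ℕ → Carrier) → Carrier
  sumTo r f = foldr _+_ 0# (map f (upTo (suc r)))

  rhs : (r : ℕ) → Vec ℕ r → Vec Carrier r → ℕ → ℕ → Carrier
  rhs r ks xs l n =
    pow (- 1#) r *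
      sumTo r (λ j → pow (- 1#) j *
        (zetaStar (n +ℕ l) (take j L) * zeta l (reverse (drop j L))))
    where
    L : List (ℕ × Carrier)
    L = toList (zip ks xs)

  lhs : (r : ℕ) → Vec ℕ r → Vec Carrier r → ℕ → ℕ → Carrier
  lhs r ks xs l n = shiftedStar l n (toList (zip ks xs))

-- Let A_M(L) = Σ_j (-1)^j ζ⋆_M(first j entries of L) ζ_l(remaining entries, reversed).
-- Splitting off the outermost sum of each ζ⋆ gives
--   A_M(x ∷ L) = ζ_l(reverse (x ∷ L)) − Σ_{m ≤ M} w_x(m) A_m(L),   w_x(m) = x^m/m^k.
-- Read from the innermost index, ζ_l(reverse L) is the ascending sum over 0 < p_1 < ⋯ < p_s ≤ l,
-- and the ascending sums over M < p_1 < ⋯ < p_s ≤ l obey the same recursion in M; so A_M(L)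
-- equals that sum for M ≤ l and vanishes at M = l when L ≠ [].  The left-hand side, whose
-- summation variables are shifted by l, obeys the recursion in n of (-1)^r A_{n+l}(L), and both
-- vanish at n = 0.
module Submission where

open import Defs
open import Algebra.Bundles using (CommutativeRing)
open import Data.Nat using (ℕ; suc; _≤_)
open import Data.Vec using (Vec; zip; toList)
open import Data.Vec.Relation.Unary.All using (All)

open import Level using (Level)
open import Data.Nat using (zero; _<_; _∸_; pred; z≤n; s≤s) renaming (_+_ to _+ℕ_)
open import Data.Nat.Properties as ℕₚ
  using (≤-refl; <⇒≤; m<n⇒m<1+n; n∸n≡0; +-suc; +-∸-assoc; m+[n∸m]≡n; +-monoʳ-≤)
open import Data.List using (List; []; _∷_; _∷ʳ_; take; drop; reverse; applyUpTo; foldr; length)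
open import Data.List.Properties using (unfold-reverse; reverse-involutive; map-upTo)
open import Data.Product using (_×_; _,_)
open import Data.Vec.Properties using (length-toList)
open import Relation.Binary.PropositionalEquality as ≡ using (_≡_)

m+suc[n∸m]≡1+n : ∀ {m n} → m ≤ n → m +ℕ suc (n ∸ m) ≡ suc n
m+suc[n∸m]≡1+n {m} {n} m≤n = ≡.trans (+-suc m (n ∸ m)) (≡.cong suc (m+[n∸m]≡n m≤n))

module ZetaDuality {c ℓ : Level} (R : CommutativeRing c ℓ) (inv : ℕ → CommutativeRing.Carrier R) where
  open CommutativeRing R
  open Zeta R inv
  open import Algebra.Properties.Ring ring
    using (-1*x≈-x; -0#≈0#; -‿+-comm; -‿involutive; x[y-z]≈xy-xz; xyx⁻¹≈y)
  open import Algebra.Properties.CommutativeSemigroup +-commutativeSemigroup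
    using () renaming (interchange to +-interchange)
  open import Algebra.Properties.CommutativeSemigroup *-commutativeSemigroup
    using () renaming (x∙yz≈y∙xz to *-swapˡ)
  open import Relation.Binary.Reasoning.Setoid setoid

  Index : Set c
  Index = List (ℕ × Carrier)

  sum1-cong : ∀ N {f g : ℕ → Carrier} → (∀ m → m < N → f (suc m) ≈ g (suc m)) → sum1 N f ≈ sum1 N g
  sum1-cong zero    f≈g = refl
  sum1-cong (suc N) f≈g = +-cong (sum1-cong N (λ m m<N → f≈g m (m<n⇒m<1+n m<N))) (f≈g N ≤-refl)

  sum1-suc : ∀ N f → sum1 (suc N) f ≈ f 1 + sum1 N (λ m → f (suc m))
  sum1-suc zero    f = +-comm 0# (f 1)
  sum1-suc (suc N) f = trans (+-congʳ (sum1-suc N f)) (+-assoc _ _ _)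

  sum1-zero : ∀ N → sum1 N (λ _ → 0#) ≈ 0#
  sum1-zero zero    = refl
  sum1-zero (suc N) = trans (+-congʳ (sum1-zero N)) (+-identityʳ 0#)

  sum1-+ : ∀ N f g → sum1 N (λ m → f m + g m) ≈ sum1 N f + sum1 N g
  sum1-+ zero    f g = sym (+-identityʳ 0#)
  sum1-+ (suc N) f g = trans (+-congʳ (sum1-+ N f g)) (+-interchange _ _ _ _)

  *-distribˡ-sum1 : ∀ N a f → a * sum1 N f ≈ sum1 N (λ m → a * f m)
  *-distribˡ-sum1 zero    a f = zeroʳ a
  *-distribˡ-sum1 (suc N) a f = trans (distribˡ a _ _) (+-congʳ (*-distribˡ-sum1 N a f))

  *-distribʳ-sum1 : ∀ N a f → sum1 N f * a ≈ sum1 N (λ m → f m * a)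
  *-distribʳ-sum1 zero    a f = zeroˡ a
  *-distribʳ-sum1 (suc N) a f = trans (distribʳ a _ _) (+-congʳ (*-distribʳ-sum1 N a f))

  -‿sum1 : ∀ N f → - sum1 N f ≈ sum1 N (λ m → - f m)
  -‿sum1 zero    f = -0#≈0#
  -‿sum1 (suc N) f = trans (sym (-‿+-comm _ _)) (+-congʳ (-‿sum1 N f))

  sum1-comm : ∀ A B (F : ℕ → ℕ → Carrier) →
    sum1 A (λ a → sum1 B (F a)) ≈ sum1 B (λ b → sum1 A (λ a → F a b))
  sum1-comm zero    B F = sym (sum1-zero B)
  sum1-comm (suc A) B F = trans (+-congʳ (sum1-comm A B F)) (sym (sum1-+ B _ (F (suc A))))

  foldr-applyUpTo≈sum1 : ∀ n f → foldr _+_ 0# (applyUpTo f n) ≈ sum1 n (λ j → f (pred j))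
  foldr-applyUpTo≈sum1 zero    f = refl
  foldr-applyUpTo≈sum1 (suc n) f = begin
    f 0 + foldr _+_ 0# (applyUpTo (λ j → f (suc j)) n)
      ≈⟨ +-congˡ (foldr-applyUpTo≈sum1 n (λ j → f (suc j))) ⟩
    f 0 + sum1 n (λ j → f (suc (pred j)))
      ≈⟨ +-congˡ (sum1-cong n (λ _ _ → refl)) ⟩
    f 0 + sum1 n f
      ≈⟨ sum1-suc n (λ j → f (pred j)) ⟨
    sum1 (suc n) (λ j → f (pred j)) ∎

  sumTo≈sum1 : ∀ r f → sumTo r f ≈ sum1 (suc r) (λ j → f (pred j))
  sumTo≈sum1 r f =
    trans (reflexive (≡.cong (foldr _+_ 0#) (map-upTo f (suc r)))) (foldr-applyUpTo≈sum1 (suc r) f)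

  sub-+-assoc : ∀ a b c → a - (b + c) ≈ (a - b) - c
  sub-+-assoc a b c = trans (+-congˡ (sym (-‿+-comm b c))) (sym (+-assoc a (- b) (- c)))

  -1*-swap : ∀ s t x → (- 1# * s) * (t * x) ≈ - (t * (s * x))
  -1*-swap s t x = begin
    (- 1# * s) * (t * x) ≈⟨ *-assoc (- 1#) s (t * x) ⟩
    - 1# * (s * (t * x)) ≈⟨ -1*x≈-x _ ⟩
    - (s * (t * x))      ≈⟨ -‿cong (*-swapˡ s t x) ⟩
    - (t * (s * x))      ∎

  -1*-sub : ∀ s a t b → (- 1# * s) * (a - t * b) ≈ (- 1# * s) * a + t * (s * b)
  -1*-sub s a t b = begin
    (- 1# * s) * (a - t * b)                ≈⟨ x[y-z]≈xy-xz (- 1# * s) a (t * b) ⟩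
    (- 1# * s) * a - (- 1# * s) * (t * b)   ≈⟨ +-congˡ (-‿cong (-1*-swap s t b)) ⟩
    (- 1# * s) * a - - (t * (s * b))        ≈⟨ +-congˡ (-‿involutive _) ⟩
    (- 1# * s) * a + t * (s * b)            ∎

  -- zetaAsc l M L is the sum over M < p_1 < ⋯ < p_s ≤ l of ∏ y_i^{p_i}/p_i^{k_i}, where L = (k_i , y_i)_i.
  zetaAsc : ℕ → ℕ → Index → Carrier
  zetaAsc l M []             = 1#
  zetaAsc l M ((k , y) ∷ L) = sum1 (l ∸ M) (λ i → term k y (M +ℕ i) * zetaAsc l (M +ℕ i) L)

  zetaAsc-self : ∀ l x L → zetaAsc l l (x ∷ L) ≈ 0#
  zetaAsc-self l (k , y) L rewrite n∸n≡0 l = refl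

  zetaAsc-self-∷ʳ : ∀ l L x → zetaAsc l l (L ∷ʳ x) ≈ 0#
  zetaAsc-self-∷ʳ l []      x = zetaAsc-self l x []
  zetaAsc-self-∷ʳ l (y ∷ L) x = zetaAsc-self l y (L ∷ʳ x)

  zetaAsc-peel : ∀ {l M} k y L → M < l →
    zetaAsc l M ((k , y) ∷ L) ≈ term k y (suc M) * zetaAsc l (suc M) L + zetaAsc l (suc M) ((k , y) ∷ L)
  zetaAsc-peel {suc l} {M} k y L (s≤s M≤l) rewrite +-∸-assoc 1 M≤l =
    trans (sum1-suc (l ∸ M) (λ i → f (M +ℕ i)))
          (+-cong (reflexive (≡.cong f (ℕₚ.+-comm M 1)))
                  (sum1-cong (l ∸ M) (λ i _ → reflexive (≡.cong f (+-suc M (suc i))))))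
    where
    f : ℕ → Carrier
    f p = term k y p * zetaAsc (suc l) p L

  zetaAsc-∷ʳ : ∀ {l M} L k y → M ≤ l →
    zetaAsc (suc l) M (L ∷ʳ (k , y)) ≈ zetaAsc l M (L ∷ʳ (k , y)) + term k y (suc l) * zetaAsc l M L
  zetaAsc-∷ʳ {l} {M} [] k y M≤l rewrite +-∸-assoc 1 M≤l =
    +-congˡ (reflexive (≡.cong (λ p → term k y p * 1#) (m+suc[n∸m]≡1+n M≤l)))
  zetaAsc-∷ʳ {l} {M} ((k′ , y′) ∷ L) k y M≤l rewrite +-∸-assoc 1 M≤l = begin
    sum1 (l ∸ M) (λ i → f (M +ℕ i)) + f (M +ℕ suc (l ∸ M))
      ≈⟨ +-cong (sum1-cong (l ∸ M) (λ i i<d → split (M +ℕ suc i) (inRange i<d))) top-vanishes ⟩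
    sum1 (l ∸ M) (λ i → g (M +ℕ i) + t * h (M +ℕ i)) + 0#
      ≈⟨ +-identityʳ _ ⟩
    sum1 (l ∸ M) (λ i → g (M +ℕ i) + t * h (M +ℕ i))
      ≈⟨ sum1-+ (l ∸ M) _ _ ⟩
    zetaAsc l M ((k′ , y′) ∷ L ∷ʳ (k , y)) + sum1 (l ∸ M) (λ i → t * h (M +ℕ i))
      ≈⟨ +-congˡ (*-distribˡ-sum1 (l ∸ M) t _) ⟨
    zetaAsc l M ((k′ , y′) ∷ L ∷ʳ (k , y)) + t * zetaAsc l M ((k′ , y′) ∷ L) ∎
    where
    t : Carrier
    t = term k y (suc l)
    f g h : ℕ → Carrier
    f p = term k′ y′ p * zetaAsc (suc l) p (L ∷ʳ (k , y))
    g p = term k′ y′ p * zetaAsc l p (L ∷ʳ (k , y))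
    h p = term k′ y′ p * zetaAsc l p L
    inRange : ∀ {i} → i < l ∸ M → M +ℕ suc i ≤ l
    inRange i<d = ≡.subst (_ ≤_) (m+[n∸m]≡n M≤l) (+-monoʳ-≤ M i<d)
    split : ∀ p → p ≤ l → f p ≈ g p + t * h p
    split p p≤l =
      trans (*-congˡ (zetaAsc-∷ʳ L k y p≤l)) (trans (distribˡ _ _ _) (+-congˡ (*-swapˡ _ t _)))
    top-vanishes : f (M +ℕ suc (l ∸ M)) ≈ 0#
    top-vanishes rewrite m+suc[n∸m]≡1+n M≤l =
      trans (*-congˡ (zetaAsc-self-∷ʳ (suc l) L (k , y))) (zeroʳ _)

  zeta≈zetaAsc-reverse : ∀ l K → zeta l K ≈ zetaAsc l 0 (reverse K)
  zeta≈zetaAsc-reverse l       [] = refl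
  zeta≈zetaAsc-reverse zero    (x ∷ K) rewrite unfold-reverse x K =
    sym (zetaAsc-self-∷ʳ 0 (reverse K) x)
  zeta≈zetaAsc-reverse (suc l) ((k , y) ∷ K) = begin
    zeta l ((k , y) ∷ K) + term k y (suc l) * zeta l K
      ≈⟨ +-cong (zeta≈zetaAsc-reverse l ((k , y) ∷ K)) (*-congˡ (zeta≈zetaAsc-reverse l K)) ⟩
    zetaAsc l 0 (reverse ((k , y) ∷ K)) + term k y (suc l) * zetaAsc l 0 (reverse K)
      ≈⟨ +-congʳ (reflexive (≡.cong (zetaAsc l 0) (unfold-reverse (k , y) K))) ⟩
    zetaAsc l 0 (reverse K ∷ʳ (k , y)) + term k y (suc l) * zetaAsc l 0 (reverse K)
      ≈⟨ zetaAsc-∷ʳ (reverse K) k y z≤n ⟨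
    zetaAsc (suc l) 0 (reverse K ∷ʳ (k , y))
      ≡⟨ ≡.cong (zetaAsc (suc l) 0) (unfold-reverse (k , y) K) ⟨
    zetaAsc (suc l) 0 (reverse ((k , y) ∷ K)) ∎

  zeta-reverse≈zetaAsc : ∀ l L → zeta l (reverse L) ≈ zetaAsc l 0 L
  zeta-reverse≈zetaAsc l L =
    trans (zeta≈zetaAsc-reverse l (reverse L)) (reflexive (≡.cong (zetaAsc l 0) (reverse-involutive L)))

  altZeta : ℕ → ℕ → Index → Carrier
  altZeta l M []             = 1#
  altZeta l M ((k , y) ∷ L) = zeta l (reverse ((k , y) ∷ L)) - sum1 M (λ m → term k y m * altZeta l m L)

  altZeta-suc : ∀ l M k y L →
    altZeta l (suc M) ((k , y) ∷ L) ≈ altZeta l M ((k , y) ∷ L) - term k y (suc M) * altZeta l (suc M) L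
  altZeta-suc l M k y L = sub-+-assoc _ _ _

  altZeta≈zetaAsc : ∀ l M L → M ≤ l → altZeta l M L ≈ zetaAsc l M L
  altZeta≈zetaAsc l M       []             _   = refl
  altZeta≈zetaAsc l zero    ((k , y) ∷ L) _   =
    trans (+-congˡ -0#≈0#) (trans (+-identityʳ _) (zeta-reverse≈zetaAsc l ((k , y) ∷ L)))
  altZeta≈zetaAsc l (suc M) ((k , y) ∷ L) M<l = begin
    altZeta l (suc M) ((k , y) ∷ L)
      ≈⟨ altZeta-suc l M k y L ⟩
    altZeta l M ((k , y) ∷ L) - t * altZeta l (suc M) L
      ≈⟨ +-cong (altZeta≈zetaAsc l M ((k , y) ∷ L) (<⇒≤ M<l))
                (-‿cong (*-congˡ (altZeta≈zetaAsc l (suc M) L M<l))) ⟩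
    zetaAsc l M ((k , y) ∷ L) - t * zetaAsc l (suc M) L
      ≈⟨ +-congʳ (zetaAsc-peel k y L M<l) ⟩
    t * zetaAsc l (suc M) L + zetaAsc l (suc M) ((k , y) ∷ L) - t * zetaAsc l (suc M) L
      ≈⟨ xyx⁻¹≈y _ _ ⟩
    zetaAsc l (suc M) ((k , y) ∷ L) ∎
    where
    t : Carrier
    t = term k y (suc M)

  altZeta-self : ∀ l x L → altZeta l l (x ∷ L) ≈ 0#
  altZeta-self l x L = trans (altZeta≈zetaAsc l l (x ∷ L) ≤-refl) (zetaAsc-self l x L)

  shiftedStar≈altZeta : ∀ l n L → shiftedStar l n L ≈ pow (- 1#) (length L) * altZeta l (n +ℕ l) L
  shiftedStar≈altZeta l n       []             = sym (*-identityˡ 1#)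
  shiftedStar≈altZeta l zero    (x ∷ L)       = sym (trans (*-congˡ (altZeta-self l x L)) (zeroʳ _))
  shiftedStar≈altZeta l (suc n) ((k , y) ∷ L) = begin
    shiftedStar l n ((k , y) ∷ L) + t * shiftedStar l (suc n) L
      ≈⟨ +-cong (shiftedStar≈altZeta l n ((k , y) ∷ L)) (*-congˡ (shiftedStar≈altZeta l (suc n) L)) ⟩
    (- 1# * s) * altZeta l (n +ℕ l) ((k , y) ∷ L) + t * (s * altZeta l (suc n +ℕ l) L)
      ≈⟨ -1*-sub s _ t _ ⟨
    (- 1# * s) * (altZeta l (n +ℕ l) ((k , y) ∷ L) - t * altZeta l (suc n +ℕ l) L)
      ≈⟨ *-congˡ (altZeta-suc l (n +ℕ l) k y L) ⟨
    (- 1# * s) * altZeta l (suc n +ℕ l) ((k , y) ∷ L) ∎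
    where
    s t : Carrier
    s = pow (- 1#) (length L)
    t = term k y (suc n +ℕ l)

  alternatingTerm : ℕ → ℕ → Index → ℕ → Carrier
  alternatingTerm l M L j = pow (- 1#) j * (zetaStar M (take j L) * zeta l (reverse (drop j L)))

  alternatingTerm-suc : ∀ l M k y L j →
    alternatingTerm l M ((k , y) ∷ L) (suc j) ≈ - sum1 M (λ m → term k y m * alternatingTerm l m L j)
  alternatingTerm-suc l M k y L j = begin
    (- 1# * s) * (sum1 M (λ m → term k y m * zetaStar m (take j L)) * Z)
      ≈⟨ *-congˡ (*-distribʳ-sum1 M Z _) ⟩
    (- 1# * s) * sum1 M (λ m → (term k y m * zetaStar m (take j L)) * Z)
      ≈⟨ *-distribˡ-sum1 M (- 1# * s) _ ⟩
    sum1 M (λ m → (- 1# * s) * ((term k y m * zetaStar m (take j L)) * Z))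
      ≈⟨ sum1-cong M (λ m _ → trans (*-congˡ (*-assoc _ _ Z)) (-1*-swap s _ _)) ⟩
    sum1 M (λ m → - (term k y m * alternatingTerm l m L j))
      ≈⟨ -‿sum1 M _ ⟨
    - sum1 M (λ m → term k y m * alternatingTerm l m L j) ∎
    where
    s Z : Carrier
    s = pow (- 1#) j
    Z = zeta l (reverse (drop j L))

  sumTo-alternatingTerm : ∀ l M L → sumTo (length L) (alternatingTerm l M L) ≈ altZeta l M L
  sumTo-alternatingTerm l M [] = trans (+-identityʳ _) (trans (*-identityˡ _) (*-identityˡ _))
  sumTo-alternatingTerm l M ((k , y) ∷ L) = begin
    sumTo (suc n) F
      ≈⟨ sumTo≈sum1 (suc n) F ⟩
    sum1 (suc (suc n)) (λ j → F (pred j))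
      ≈⟨ sum1-suc (suc n) (λ j → F (pred j)) ⟩
    F 0 + sum1 (suc n) F
      ≈⟨ +-cong (trans (*-identityˡ _) (*-identityˡ _))
                (sum1-cong (suc n) (λ j _ → alternatingTerm-suc l M k y L j)) ⟩
    zeta l (reverse ((k , y) ∷ L)) + sum1 (suc n) (λ j → - sum1 M (λ m → w m * G m (pred j)))
      ≈⟨ +-congˡ (sym (-‿sum1 (suc n) _)) ⟩
    zeta l (reverse ((k , y) ∷ L)) - sum1 (suc n) (λ j → sum1 M (λ m → w m * G m (pred j)))
      ≈⟨ +-congˡ (-‿cong (sum1-comm (suc n) M _)) ⟩
    zeta l (reverse ((k , y) ∷ L)) - sum1 M (λ m → sum1 (suc n) (λ j → w m * G m (pred j)))
      ≈⟨ +-congˡ (-‿cong (sum1-cong M (λ m _ → inner (suc m)))) ⟩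
    altZeta l M ((k , y) ∷ L) ∎
    where
    n : ℕ
    n = length L
    F : ℕ → Carrier
    F = alternatingTerm l M ((k , y) ∷ L)
    w : ℕ → Carrier
    w = term k y
    G : ℕ → ℕ → Carrier
    G m = alternatingTerm l m L
    inner : ∀ m → sum1 (suc n) (λ j → w m * G m (pred j)) ≈ w m * altZeta l m L
    inner m = begin
      sum1 (suc n) (λ j → w m * G m (pred j)) ≈⟨ *-distribˡ-sum1 (suc n) (w m) _ ⟨
      w m * sum1 (suc n) (λ j → G m (pred j)) ≈⟨ *-congˡ (sumTo≈sum1 n (G m)) ⟨
      w m * sumTo n (G m)                    ≈⟨ *-congˡ (sumTo-alternatingTerm l m L) ⟩
      w m * altZeta l m L                    ∎

  shiftedStar-duality : ∀ l n L r → length L ≡ r →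
    shiftedStar l n L ≈ pow (- 1#) r * sumTo r (alternatingTerm l (n +ℕ l) L)
  shiftedStar-duality l n L _ ≡.refl =
    trans (shiftedStar≈altZeta l n L) (*-congˡ (sym (sumTo-alternatingTerm l (n +ℕ l) L)))

theorem4p4 : ∀ {c ℓ} (R : CommutativeRing c ℓ)
    (inv : ℕ → CommutativeRing.Carrier R)
    (inv-spec : Zeta.InvertsPositive R inv)
    (r : ℕ) (k : Vec ℕ r) (x : Vec (CommutativeRing.Carrier R) r) →
    All (1 ≤_) k → (l n : ℕ) → 1 ≤ n →
    CommutativeRing._≈_ R (Zeta.lhs R inv r k x l n) (Zeta.rhs R inv r k x l n)
theorem4p4 R inv _ r k x _ l n _ =
  ZetaDuality.shiftedStar-duality R inv l n (toList (zip k x)) r (length-toList (zip k x))
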